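{- Let $H$ be a connected bipartite graph with $n \ge 4$ vertices that has a Hamiltonian path. Then $F(H) \ge \lceil n/2 \rceil - 1 = \alpha(H) - 1$.
   Context: Peg solitaire on a graph: a configuration assigns to each vertex either a peg or a hole. If $x,y,z$ form a path $xyz$ with pegs at $x$ and $y$ and a hole at $z$, a jump $xyz$ removes the pegs at $x$ and $y$ and places a peg at $z$. A terminal state of a graph $G$ is the set of peg locations when no jump is available, reached by some sequence of jumps from a starting configuration with exactly one hole (and pegs on all other vertices). The fool's solitaire number $F(G)$ is the maximum size of a terminal state of $G$. $\alpha$ is the independence number. -}

module Defs where

open import Data.Nat using (ℕ; suc)
open import Data.Bool using (Bool; true; false)
open import Data.Fin using (Fin; toℕ)
open import Data.Fin.Subset using (Subset; inside; outside; _∈_; _∉_; ∣_∣)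
open import Data.Vec using (_[_]≔_)
open import Data.Product using (Σ; ∃; _×_; _,_)
open import Data.Empty using (⊥)
open import Relation.Nullary using (¬_)
open import Relation.Binary.PropositionalEquality using (_≡_; _≢_)
open import Function.Definitions using (Injective)

record Graph (n : ℕ) : Set where
  field
    adj     : Fin n → Fin n → Bool
    adj-sym : ∀ u v → adj u v ≡ adj v u
    adj-irr : ∀ u → adj u u ≡ false

module _ {n : ℕ} (G : Graph n) where
  open Graph G

  Adj : Fin n → Fin n → Set
  Adj u v = adj u v ≡ true

  data Walk : Fin n → Fin n → Set where
    here : ∀ {u} → Walk u u
    step : ∀ {u v w} → Adj u v → Walk v w → Walk u w

  Connected : Set
  Connected = ∀ u v → Walk u v

  Bipartite : Set
  Bipartite = Σ (Fin n → Bool) λ c → ∀ u v → Adj u v → c u ≢ c v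

  -- a Hamiltonian path: an ordering p of all vertices (injective, hence
  -- bijective on Fin n) with consecutive vertices adjacent
  HamiltonianPath : Set
  HamiltonianPath = Σ (Fin n → Fin n) λ p →
    Injective _≡_ _≡_ p × (∀ i j → toℕ j ≡ suc (toℕ i) → Adj (p i) (p j))

  Independent : Subset n → Set
  Independent S = ∀ u v → u ∈ S → v ∈ S → ¬ Adj u v

  IndependenceNumber : ℕ → Set
  IndependenceNumber k =
    (∃ λ S → Independent S × ∣ S ∣ ≡ k) ×
    (∀ S → Independent S → ∣ S ∣ Data.Nat.≤ k)

  -- Configurations: the set of vertices carrying a peg (inside = peg).
  -- A jump xyz along the path xyz (x,y,z distinct, x~y, y~z) with pegs at
  -- x,y and a hole at z.
  record Jump (c : Subset n) (x y z : Fin n) : Set where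
    field
      x≢y : x ≢ y
      y≢z : y ≢ z
      x≢z : x ≢ z
      xy  : Adj x y
      yz  : Adj y z
      px  : x ∈ c
      py  : y ∈ c
      hz  : z ∉ c

  jump : Subset n → Fin n → Fin n → Fin n → Subset n
  jump c x y z = ((c [ x ]≔ outside) [ y ]≔ outside) [ z ]≔ inside

  data Reach : Subset n → Subset n → Set where
    done : ∀ {c} → Reach c c
    move : ∀ {c d} x y z → Jump c x y z → Reach (jump c x y z) d → Reach c d

  OneHole : Fin n → Subset n
  OneHole h = Data.Fin.Subset.⊤ [ h ]≔ outside

  NoJump : Subset n → Set
  NoJump c = ∀ x y z → ¬ Jump c x y z

  TerminalState : Subset n → Set
  TerminalState c = (∃ λ h → Reach (OneHole h) c) × NoJump c

  -- F(G) ≥ k  (F(G) is the maximum size of a terminal state)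
  FoolsAtLeast : ℕ → Set
  FoolsAtLeast k = ∃ λ c → TerminalState c × k Data.Nat.≤ ∣ c ∣

-- Number the vertices 0, …, n − 1 along the Hamiltonian path. Consecutive
-- vertices are adjacent, so in a 2-colouring the colour of a vertex only
-- depends on the parity of its position. For n odd, start with the hole at
-- 0 and jump 2 → 1 → 0, 4 → 3 → 2, …: the hole is swept to n − 1 and the pegs
-- end up exactly on 0, 2, …, n − 3. For n even, first jump 0 → 1 → 2 into a
-- hole at 2 and sweep in the same way from 1, leaving pegs on 1, 3, …, n − 3.
-- Either way the ⌈n/2⌉ − 1 remaining pegs share a colour, so no two of them
-- are adjacent and no jump is possible. By the same colour argument the even
-- positions form an independent set of size ⌈n/2⌉, and no independent set
-- can contain two consecutive vertices of the path, so none is larger.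
module Submission where

open import Defs
open import Data.Nat using (ℕ; _≤_; _∸_; ⌈_/2⌉)
open import Data.Product using (_×_)

open import Data.Nat using (zero; suc; _+_; _<_; _<?_; z≤n; s≤s; s≤s⁻¹; parity)
import Data.Nat.Properties as ℕ
open import Data.Parity.Base using (Parity; 0ℙ; _⁻¹)
open import Data.Parity.Properties using (suc-homo-⁻¹; ⁻¹-selfInverse)
open import Data.Bool using (Bool; true; false; not)
open import Data.Bool.Properties using (¬-not; not-involutive)
open import Data.Fin using (Fin; toℕ; fromℕ<; punchOut)
import Data.Fin.Properties as Fin
open import Data.Fin.Subset using (Subset; inside; outside; _∈_; ∣_∣; ⊤)
open import Data.Fin.Permutation using (permutation)
open import Data.List using (List; []; _∷_; _++_; length; applyUpTo)
open import Data.List.Properties using (length-++; ++-assoc; length-applyUpTo)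
open import Data.Vec as Vec using (lookup; tabulate; _[_]≔_)
open import Data.Vec.Properties
  using (lookup∘tabulate; tabulate-cong; tabulate∘lookup; lookup∘update; lookup∘update′;
         lookup-replicate; lookup⇒[]=; []=⇒lookup)
open import Data.Product using (∃; _,_; proj₁; proj₂)
open import Data.Empty using (⊥; ⊥-elim)
open import Function using (_∘_; case_of_)
open import Function.Definitions using (Injective)
open import Relation.Nullary using (yes; no; contradiction)
open import Relation.Binary.PropositionalEquality
open import Algebra.Properties.CommutativeMonoid.Sum ℕ.+-0-commutativeMonoid
  using (sum; sum-permute; sum-cong-≗)

injective⇒surjective : ∀ {n} {f : Fin n → Fin n} → Injective _≡_ _≡_ f →
  ∀ v → ∃ λ i → f i ≡ v
injective⇒surjective {suc n} {f} f-injective v with Fin.any? (λ i → f i Fin.≟ v)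
... | yes hit = hit
... | no miss = contradiction (Fin.injective⇒≤ punchOut∘f-injective) ℕ.1+n≰n
  where
  f≢v : ∀ i → v ≢ f i
  f≢v i v≡fi = miss (i , sym v≡fi)
  punchOut∘f-injective : Injective _≡_ _≡_ (λ i → punchOut (f≢v i))
  punchOut∘f-injective e = f-injective (Fin.punchOut-injective (f≢v _) (f≢v _) e)

Adj-sym : ∀ {n} (G : Graph n) {u v} → Adj G u v → Adj G v u
Adj-sym G {u} {v} uv = trans (Graph.adj-sym G v u) uv

independent⇒noJump : ∀ {n} {G : Graph n} {c} → Independent G c → NoJump G c
independent⇒noJump independent x y z J =
  independent x y (Jump.px J) (Jump.py J) (Jump.xy J)

boolToℕ : Bool → ℕ
boolToℕ true  = 1
boolToℕ false = 0

∣S∣≡sum : ∀ {n} (S : Subset n) → ∣ S ∣ ≡ sum (boolToℕ ∘ lookup S)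
∣S∣≡sum Vec.[]          = refl
∣S∣≡sum (true  Vec.∷ S) = cong suc (∣S∣≡sum S)
∣S∣≡sum (false Vec.∷ S) = ∣S∣≡sum S

-- Peg patterns listed in path order; positions beyond the list are holes.
at : List Bool → ℕ → Bool
at []      _       = false
at (b ∷ L) zero    = b
at (b ∷ L) (suc i) = at L i

pegs : List Bool → ℕ
pegs []      = 0
pegs (b ∷ L) = boolToℕ b + pegs L

sum-at : ∀ {n} L → length L ≡ n → sum (λ (i : Fin n) → boolToℕ (at L (toℕ i))) ≡ pegs L
sum-at []      refl = refl
sum-at (b ∷ L) refl = cong (boolToℕ b +_) (sum-at L refl)

at≡true⇒< : ∀ L {i} → at L i ≡ true → i < length L
at≡true⇒< (b ∷ L) {zero}  _    = s≤s z≤n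
at≡true⇒< (b ∷ L) {suc i} peg = s≤s (at≡true⇒< L peg)

at-applyUpTo : ∀ (f : ℕ → Bool) n {i} → i < n → at (applyUpTo f n) i ≡ f i
at-applyUpTo f (suc n) {zero}  _     = refl
at-applyUpTo f (suc n) {suc i} i<1+n = at-applyUpTo (f ∘ suc) n (s≤s⁻¹ i<1+n)

at-++ʳ : ∀ pre L i → at (pre ++ L) (i + length pre) ≡ at L i
at-++ʳ []        L i = cong (at L) (ℕ.+-identityʳ i)
at-++ʳ (b ∷ pre) L i = trans (cong (at (b ∷ pre ++ L)) (ℕ.+-suc i (length pre))) (at-++ʳ pre L i)

at-outside-window : ∀ pre rest {b₀ b₁ b₂ c₀ c₁ c₂} i →
  i ≢ length pre → i ≢ suc (length pre) → i ≢ suc (suc (length pre)) →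
  at (pre ++ c₀ ∷ c₁ ∷ c₂ ∷ rest) i ≡ at (pre ++ b₀ ∷ b₁ ∷ b₂ ∷ rest) i
at-outside-window []        rest zero                   ≢₀ _  _  = ⊥-elim (≢₀ refl)
at-outside-window []        rest (suc zero)             _  ≢₁ _  = ⊥-elim (≢₁ refl)
at-outside-window []        rest (suc (suc zero))       _  _  ≢₂ = ⊥-elim (≢₂ refl)
at-outside-window []        rest (suc (suc (suc i)))    _  _  _  = refl
at-outside-window (b ∷ pre) rest zero                   _  _  _  = refl
at-outside-window (b ∷ pre) rest (suc i) ≢₀ ≢₁ ≢₂ =
  at-outside-window pre rest i (≢₀ ∘ cong suc) (≢₁ ∘ cong suc) (≢₂ ∘ cong suc)

window-fits : ∀ (pre : List Bool) {b₀ b₁ b₂} rest → 3 + length pre ≤ length (pre ++ b₀ ∷ b₁ ∷ b₂ ∷ rest)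
window-fits []        rest = s≤s (s≤s (s≤s z≤n))
window-fits (b ∷ pre) rest = s≤s (window-fits pre rest)

data LocalJump : List Bool → List Bool → Set where
  rightward : LocalJump (true ∷ true ∷ false ∷ []) (false ∷ false ∷ true ∷ [])
  leftward  : LocalJump (false ∷ true ∷ true ∷ []) (true ∷ false ∷ false ∷ [])

pegPairs : ℕ → List Bool
pegPairs zero    = []
pegPairs (suc j) = true ∷ true ∷ pegPairs j

-- the pattern left behind when a hole is swept through pegPairs j
swept : ℕ → List Bool
swept zero    = false ∷ []
swept (suc j) = true ∷ false ∷ swept j

alternating : ℕ → List Bool
alternating zero          = []
alternating (suc zero)    = true ∷ []
alternating (suc (suc n)) = true ∷ false ∷ alternating n

at-pegPairs : ∀ j {i} → i < length (pegPairs j) → at (pegPairs j) i ≡ true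
at-pegPairs (suc j) {zero}        _ = refl
at-pegPairs (suc j) {suc zero}    _ = refl
at-pegPairs (suc j) {suc (suc i)} i<len = at-pegPairs j (s≤s⁻¹ (s≤s⁻¹ i<len))

length-pegPairs : ∀ j → length (pegPairs j) ≡ j + j
length-pegPairs zero    = refl
length-pegPairs (suc j) = cong suc (trans (cong suc (length-pegPairs j)) (sym (ℕ.+-suc j j)))

length-swept : ∀ pre j → length (pre ++ swept j) ≡ length (pre ++ false ∷ pegPairs j)
length-swept pre j = trans (length-++ pre) (trans (cong (length pre +_) (swept-length j))
  (sym (length-++ pre)))
  where
  swept-length : ∀ j → length (swept j) ≡ length (false ∷ pegPairs j)
  swept-length zero    = refl
  swept-length (suc j) = cong (suc ∘ suc) (swept-length j)

pegs-swept : ∀ j → pegs (swept j) ≡ j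
pegs-swept zero    = refl
pegs-swept (suc j) = cong suc (pegs-swept j)

length-alternating : ∀ n → length (alternating n) ≡ n
length-alternating zero          = refl
length-alternating (suc zero)    = refl
length-alternating (suc (suc n)) = cong (suc ∘ suc) (length-alternating n)

pegs-alternating : ∀ n → pegs (alternating n) ≡ ⌈ n /2⌉
pegs-alternating zero          = refl
pegs-alternating (suc zero)    = refl
pegs-alternating (suc (suc n)) = cong suc (pegs-alternating n)

NoAdjacentPegs : List Bool → Set
NoAdjacentPegs L = ∀ i → at L i ≡ true → at L (suc i) ≡ true → ⊥

pegs≤⌈length/2⌉ : ∀ L → NoAdjacentPegs L → pegs L ≤ ⌈ length L /2⌉
pegs≤⌈length/2⌉ []                   _      = z≤n
pegs≤⌈length/2⌉ (true  ∷ [])         _      = s≤s z≤n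
pegs≤⌈length/2⌉ (false ∷ [])         _      = z≤n
pegs≤⌈length/2⌉ (true  ∷ true  ∷ L) sparse = ⊥-elim (sparse 0 refl refl)
pegs≤⌈length/2⌉ (true  ∷ false ∷ L) sparse = s≤s (pegs≤⌈length/2⌉ L (sparse ∘ suc ∘ suc))
pegs≤⌈length/2⌉ (false ∷ true  ∷ L) sparse = s≤s (pegs≤⌈length/2⌉ L (sparse ∘ suc ∘ suc))
pegs≤⌈length/2⌉ (false ∷ false ∷ L) sparse =
  ℕ.m≤n⇒m≤1+n (pegs≤⌈length/2⌉ L (sparse ∘ suc ∘ suc))

OnParity : Parity → (ℕ → Bool) → Set
OnParity π g = ∀ i → g i ≡ true → parity i ≡ π

swept-onParity : ∀ j → OnParity 0ℙ (at (swept j))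
swept-onParity zero    zero    ()
swept-onParity zero    (suc i) ()
swept-onParity (suc j) zero          _   = refl
swept-onParity (suc j) (suc zero)    ()
swept-onParity (suc j) (suc (suc i)) peg = swept-onParity j i peg

alternating-onParity : ∀ n → OnParity 0ℙ (at (alternating n))
alternating-onParity (suc zero)    zero          _   = refl
alternating-onParity (suc (suc n)) zero          _   = refl
alternating-onParity (suc (suc n)) (suc (suc i)) peg = alternating-onParity n i peg

OnParity-false∷ : ∀ {π} L → OnParity π (at L) → OnParity (π ⁻¹) (at (false ∷ L))
OnParity-false∷ L on (suc i) peg =
  trans (sym (⁻¹-selfInverse (suc-homo-⁻¹ i))) (cong _⁻¹ (on i peg))

module AlongPath {k : ℕ} (H : Graph (suc k)) {p : Fin (suc k) → Fin (suc k)}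
  (p-injective : Injective _≡_ _≡_ p)
  (p-path : ∀ i j → toℕ j ≡ suc (toℕ i) → Adj H (p i) (p j)) where

  private
    n : ℕ
    n = suc k

  index : Fin n → Fin n
  index v = proj₁ (injective⇒surjective p-injective v)

  p∘index : ∀ v → p (index v) ≡ v
  p∘index v = proj₂ (injective⇒surjective p-injective v)

  index∘p : ∀ i → index (p i) ≡ i
  index∘p i = p-injective (p∘index (p i))

  position : Fin n → ℕ
  position v = toℕ (index v)

  position<n : ∀ v → position v < n
  position<n v = Fin.toℕ<n (index v)

  -- out-of-range positions are sent to an arbitrary vertex; no lemma uses them
  vertex : ℕ → Fin n
  vertex i with i <? n
  ... | yes i<n = p (fromℕ< i<n)
  ... | no  _   = p Fin.zero

  position-vertex : ∀ {i} → i < n → position (vertex i) ≡ i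
  position-vertex {i} i<n with i <? n
  ... | yes i<n′ = trans (cong toℕ (index∘p (fromℕ< i<n′))) (Fin.toℕ-fromℕ< i<n′)
  ... | no  i≮n  = contradiction i<n i≮n

  vertex-position : ∀ v → vertex (position v) ≡ v
  vertex-position v with position v <? n
  ... | yes lt = trans (cong p (Fin.toℕ-injective (Fin.toℕ-fromℕ< lt))) (p∘index v)
  ... | no  ≮n = contradiction (position<n v) ≮n

  vertex-injective : ∀ {i j} → i < n → j < n → vertex i ≡ vertex j → i ≡ j
  vertex-injective i<n j<n eq =
    trans (sym (position-vertex i<n)) (trans (cong position eq) (position-vertex j<n))

  vertex≢ : ∀ {i j} → i < n → j < n → i ≢ j → vertex i ≢ vertex j
  vertex≢ i<n j<n i≢j = i≢j ∘ vertex-injective i<n j<n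

  adjacent : ∀ i → suc i < n → Adj H (vertex i) (vertex (suc i))
  adjacent i i+1<n with i <? n | suc i <? n
  ... | yes i<n | yes i+1<n′ =
    p-path _ _ (trans (Fin.toℕ-fromℕ< i+1<n′) (cong suc (sym (Fin.toℕ-fromℕ< i<n))))
  ... | no i≮n  | _          = contradiction (ℕ.<-trans (ℕ.n<1+n i) i+1<n) i≮n
  ... | _       | no i+1≮n   = contradiction i+1<n i+1≮n

  place : (ℕ → Bool) → Subset n
  place g = tabulate (g ∘ position)

  lookup-place : ∀ g {i} → i < n → lookup (place g) (vertex i) ≡ g i
  lookup-place g {i} i<n =
    trans (lookup∘tabulate (g ∘ position) (vertex i)) (cong g (position-vertex i<n))

  place-≡ : ∀ {g c} → (∀ i → i < n → g i ≡ lookup c (vertex i)) → place g ≡ c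
  place-≡ {g} {c} agree = trans (tabulate-cong same) (tabulate∘lookup c)
    where
    same : ∀ v → g (position v) ≡ lookup c v
    same v = trans (agree (position v) (position<n v)) (cong (lookup c) (vertex-position v))

  ∣place∣ : ∀ L → length L ≡ n → ∣ place (at L) ∣ ≡ pegs L
  ∣place∣ L len = begin
    ∣ place (at L) ∣                                 ≡⟨ ∣S∣≡sum (place (at L)) ⟩
    sum (boolToℕ ∘ lookup (place (at L)))            ≡⟨ sum-permute (boolToℕ ∘ lookup (place (at L))) (permutation p index p∘index index∘p) ⟩
    sum (boolToℕ ∘ lookup (place (at L)) ∘ p)        ≡⟨ sum-cong-≗ (cong boolToℕ ∘ lookup-place-p) ⟩
    sum (λ (i : Fin n) → boolToℕ (at L (toℕ i)))     ≡⟨ sum-at L len ⟩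
    pegs L                                           ∎
    where
    open ≡-Reasoning
    lookup-place-p : ∀ i → lookup (place (at L)) (p i) ≡ at L (toℕ i)
    lookup-place-p i = trans (lookup∘tabulate (at L ∘ position) (p i)) (cong (at L ∘ toℕ) (index∘p i))

  oneHole-place : ∀ {h} L → h < n → at L h ≡ false → (∀ i → i < n → i ≢ h → at L i ≡ true) →
    place (at L) ≡ OneHole H (vertex h)
  oneHole-place {h} L h<n hole pegged = place-≡ agree
    where
    agree : ∀ i → i < n → _ ≡ lookup (OneHole H (vertex h)) (vertex i)
    agree i i<n with i ℕ.≟ h
    ... | yes refl = trans hole (sym (lookup∘update (vertex i) ⊤ outside))
    ... | no  i≢h  = trans (pegged i i<n i≢h) (sym (trans
          (lookup∘update′ (vertex≢ i<n h<n i≢h) ⊤ outside) (lookup-replicate (vertex i) inside)))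

  record IsJump (g g′ : ℕ → Bool) (x y z : ℕ) : Set where
    field
      peg-x     : g x ≡ true
      peg-y     : g y ≡ true
      hole-z    : g z ≡ false
      hole-x′   : g′ x ≡ false
      hole-y′   : g′ y ≡ false
      peg-z′    : g′ z ≡ true
      unchanged : ∀ i → i ≢ x → i ≢ y → i ≢ z → g′ i ≡ g i

  jump-place : ∀ {g g′ x y z} → x < n → y < n → z < n → IsJump g g′ x y z →
    jump H (place g) (vertex x) (vertex y) (vertex z) ≡ place g′
  jump-place {g} {g′} {x} {y} {z} x<n y<n z<n J = sym (place-≡ agree)
    where
    open IsJump J
    c₁ c₂ : Subset n
    c₁ = place g [ vertex x ]≔ outside
    c₂ = c₁ [ vertex y ]≔ outside
    agree : ∀ i → i < n → g′ i ≡ lookup (c₂ [ vertex z ]≔ inside) (vertex i)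
    agree i i<n with i ℕ.≟ z | i ℕ.≟ y | i ℕ.≟ x
    ... | yes refl | _        | _        = trans peg-z′ (sym (lookup∘update (vertex i) c₂ inside))
    ... | no  i≢z  | yes refl | _        = trans hole-y′ (sym (trans
          (lookup∘update′ (vertex≢ i<n z<n i≢z) c₂ inside) (lookup∘update (vertex i) c₁ outside)))
    ... | no  i≢z  | no  i≢y  | yes refl = trans hole-x′ (sym (trans
          (lookup∘update′ (vertex≢ i<n z<n i≢z) c₂ inside) (trans
          (lookup∘update′ (vertex≢ i<n y<n i≢y) c₁ outside)
          (lookup∘update (vertex i) (place g) outside))))
    ... | no  i≢z  | no  i≢y  | no  i≢x  = trans (unchanged i i≢x i≢y i≢z) (sym (trans
          (lookup∘update′ (vertex≢ i<n z<n i≢z) c₂ inside) (trans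
          (lookup∘update′ (vertex≢ i<n y<n i≢y) c₁ outside) (trans
          (lookup∘update′ (vertex≢ i<n x<n i≢x) (place g) outside) (lookup-place g i<n)))))

  reach-jump : ∀ {d g g′ x y z} → x < n → y < n → z < n → x ≢ y →
    Adj H (vertex x) (vertex y) → Adj H (vertex y) (vertex z) →
    IsJump g g′ x y z → Reach H (place g′) d → Reach H (place g) d
  reach-jump {d} {g} {g′} {x} {y} {z} x<n y<n z<n x≢y xy yz J reach =
    move (vertex x) (vertex y) (vertex z) legal
      (subst (λ c → Reach H c d) (sym (jump-place x<n y<n z<n J)) reach)
    where
    open IsJump J
    distinct : ∀ {i j} → g i ≡ true → g j ≡ false → i ≢ j
    distinct gi gj refl with () ← trans (sym gi) gj
    legal : Jump H (place g) (vertex x) (vertex y) (vertex z)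
    legal = record
      { x≢y = vertex≢ x<n y<n x≢y
      ; y≢z = vertex≢ y<n z<n (distinct peg-y hole-z)
      ; x≢z = vertex≢ x<n z<n (distinct peg-x hole-z)
      ; xy  = xy
      ; yz  = yz
      ; px  = lookup⇒[]= (vertex x) (place g) (trans (lookup-place g x<n) peg-x)
      ; py  = lookup⇒[]= (vertex y) (place g) (trans (lookup-place g y<n) peg-y)
      ; hz  = λ z∈ → case trans (sym ([]=⇒lookup z∈)) (trans (lookup-place g z<n) hole-z) of λ ()
      }

  reach-window : ∀ {d} pre rest {w w′} → LocalJump w w′ → suc (suc (length pre)) < n →
    Reach H (place (at (pre ++ w′ ++ rest))) d → Reach H (place (at (pre ++ w ++ rest))) d
  reach-window pre rest rightward a+2<n =
    reach-jump a<n a+1<n a+2<n (≢-sym ℕ.1+n≢n) (adjacent _ a+1<n) (adjacent _ a+2<n) record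
      { peg-x   = at-++ʳ pre _ 0 ; peg-y   = at-++ʳ pre _ 1 ; hole-z = at-++ʳ pre _ 2
      ; hole-x′ = at-++ʳ pre _ 0 ; hole-y′ = at-++ʳ pre _ 1 ; peg-z′ = at-++ʳ pre _ 2
      ; unchanged = λ i ≢x ≢y ≢z → at-outside-window pre rest i ≢x ≢y ≢z }
    where
    a+1<n : suc (length pre) < n
    a+1<n = ℕ.m+n≤o⇒n≤o 1 a+2<n
    a<n : length pre < n
    a<n = ℕ.m+n≤o⇒n≤o 2 a+2<n
  reach-window pre rest leftward a+2<n =
    reach-jump a+2<n a+1<n a<n ℕ.1+n≢n
      (Adj-sym H (adjacent _ a+2<n)) (Adj-sym H (adjacent _ a+1<n)) record
      { peg-x   = at-++ʳ pre _ 2 ; peg-y   = at-++ʳ pre _ 1 ; hole-z = at-++ʳ pre _ 0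
      ; hole-x′ = at-++ʳ pre _ 2 ; hole-y′ = at-++ʳ pre _ 1 ; peg-z′ = at-++ʳ pre _ 0
      ; unchanged = λ i ≢x ≢y ≢z → at-outside-window pre rest i ≢z ≢y ≢x }
    where
    a+1<n : suc (length pre) < n
    a+1<n = ℕ.m+n≤o⇒n≤o 1 a+2<n
    a<n : length pre < n
    a<n = ℕ.m+n≤o⇒n≤o 2 a+2<n

  sweep : ∀ pre j → length (pre ++ false ∷ pegPairs j) ≡ n →
    Reach H (place (at (pre ++ false ∷ pegPairs j))) (place (at (pre ++ swept j)))
  sweep pre zero    _   = done
  sweep pre (suc j) len = reach-window pre (pegPairs j) leftward fits
      (subst₂ (λ L L′ → Reach H (place (at L)) (place (at L′)))
        (++-assoc pre _ _) (++-assoc pre _ _) (sweep (pre ++ true ∷ false ∷ []) j len′))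
    where
    fits : suc (suc (length pre)) < n
    fits = ℕ.≤-trans (window-fits pre {false} {true} {true} (pegPairs j)) (ℕ.≤-reflexive len)
    len′ : length ((pre ++ true ∷ false ∷ []) ++ false ∷ pegPairs j) ≡ n
    len′ = begin
      length ((pre ++ true ∷ false ∷ []) ++ false ∷ pegPairs j) ≡⟨ cong length (++-assoc pre _ _) ⟩
      length (pre ++ true ∷ false ∷ false ∷ pegPairs j)       ≡⟨ length-++ pre ⟩
      length pre + (3 + length (pegPairs j))                   ≡⟨ length-++ pre ⟨
      length (pre ++ false ∷ true ∷ true ∷ pegPairs j)        ≡⟨ len ⟩
      n                                                        ∎
      where open ≡-Reasoning

  pathOrder : Subset n → List Bool
  pathOrder S = applyUpTo (lookup S ∘ vertex) n

  place-pathOrder : ∀ S → place (at (pathOrder S)) ≡ S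
  place-pathOrder S = place-≡ (λ i i<n → at-applyUpTo (lookup S ∘ vertex) n i<n)

  independent-≤ : ∀ S → Independent H S → ∣ S ∣ ≤ ⌈ n /2⌉
  independent-≤ S independent = begin
    ∣ S ∣                  ≡⟨ cong ∣_∣ (sym (place-pathOrder S)) ⟩
    ∣ place (at L) ∣       ≡⟨ ∣place∣ L len ⟩
    pegs L                 ≤⟨ pegs≤⌈length/2⌉ L sparse ⟩
    ⌈ length L /2⌉         ≡⟨ cong ⌈_/2⌉ len ⟩
    ⌈ n /2⌉                ∎
    where
    open ℕ.≤-Reasoning
    L : List Bool
    L = pathOrder S
    len : length L ≡ n
    len = length-applyUpTo (lookup S ∘ vertex) n
    sparse : NoAdjacentPegs L
    sparse i pegᵢ pegᵢ₊₁ = independent (vertex i) (vertex (suc i))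
        (lookup⇒[]= _ S (trans (sym (at-applyUpTo (lookup S ∘ vertex) n i<n)) pegᵢ))
        (lookup⇒[]= _ S (trans (sym (at-applyUpTo (lookup S ∘ vertex) n i+1<n)) pegᵢ₊₁))
        (adjacent i i+1<n)
      where
      i+1<n : suc i < n
      i+1<n = subst (suc i <_) len (at≡true⇒< L pegᵢ₊₁)
      i<n : i < n
      i<n = ℕ.<-trans (ℕ.n<1+n i) i+1<n

  module _ (col : Fin n → Bool) (proper : ∀ u v → Adj H u v → col u ≢ col v) where

    colour-period : ∀ i → suc (suc i) < n → col (vertex (suc (suc i))) ≡ col (vertex i)
    colour-period i i+2<n = trans (flip (suc i) i+2<n)
      (trans (cong not (flip i (ℕ.<-trans (ℕ.n<1+n (suc i)) i+2<n))) (not-involutive _))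
      where
      flip : ∀ i → suc i < n → col (vertex (suc i)) ≡ not (col (vertex i))
      flip i i+1<n = ¬-not (proper _ _ (adjacent i i+1<n) ∘ sym)

    colour-parity : ∀ i j → i < n → j < n → parity i ≡ parity j →
      col (vertex i) ≡ col (vertex j)
    colour-parity zero          zero          _   _   _  = refl
    colour-parity (suc zero)    (suc zero)    _   _   _  = refl
    colour-parity zero          (suc zero)    _   _   ()
    colour-parity (suc zero)    zero          _   _   ()
    colour-parity (suc (suc i)) j             i<n j<n eq =
      trans (colour-period i i<n) (colour-parity i j (ℕ.m+n≤o⇒n≤o 2 i<n) j<n eq)
    colour-parity i             (suc (suc j)) i<n j<n eq =
      trans (colour-parity i j i<n (ℕ.m+n≤o⇒n≤o 2 j<n) eq) (sym (colour-period j j<n))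

    place-independent : ∀ {π g} → OnParity π g → Independent H (place g)
    place-independent {g = g} on u v u∈ v∈ uv = proper u v uv (begin
      col u                     ≡⟨ cong col (sym (vertex-position u)) ⟩
      col (vertex (position u)) ≡⟨ colour-parity _ _ (position<n u) (position<n v)
                                     (trans (on _ (peg u∈)) (sym (on _ (peg v∈)))) ⟩
      col (vertex (position v)) ≡⟨ cong col (vertex-position v) ⟩
      col v                     ∎)
      where
      open ≡-Reasoning
      peg : ∀ {w} → w ∈ place g → g (position w) ≡ true
      peg {w} w∈ = trans (sym (lookup∘tabulate (g ∘ position) w)) ([]=⇒lookup w∈)

    foolsAtLeast : ∀ {h π} L → Reach H (OneHole H h) (place (at L)) → OnParity π (at L) →
      length L ≡ n → FoolsAtLeast H (pegs L)
    foolsAtLeast L reach on len = place (at L) , ((_ , reach) ,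
      independent⇒noJump (place-independent on)) , ℕ.≤-reflexive (sym (∣place∣ L len))

    fools-odd : ∀ m → length (false ∷ pegPairs m) ≡ n → FoolsAtLeast H m
    fools-odd m len = subst (FoolsAtLeast H) (pegs-swept m)
      (foolsAtLeast (swept m) reach (swept-onParity m) (trans (length-swept [] m) len))
      where
      start : place (at (false ∷ pegPairs m)) ≡ OneHole H (vertex 0)
      start = oneHole-place (false ∷ pegPairs m) (s≤s z≤n) refl λ where
        zero    _     0≢0 → ⊥-elim (0≢0 refl)
        (suc i) i+1<n _   → at-pegPairs m (s≤s⁻¹ (subst (suc i <_) (sym len) i+1<n))
      reach : Reach H (OneHole H (vertex 0)) (place (at (swept m)))
      reach = subst (λ c → Reach H c (place (at (swept m)))) start (sweep [] m len)

    fools-even : ∀ m → length (true ∷ true ∷ false ∷ true ∷ pegPairs m) ≡ n →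
      FoolsAtLeast H (suc m)
    fools-even m len = subst (FoolsAtLeast H) (pegs-swept (suc m))
      (foolsAtLeast (false ∷ swept (suc m)) reach
        (OnParity-false∷ (swept (suc m)) (swept-onParity (suc m)))
        (trans (length-swept (false ∷ []) (suc m)) len))
      where
      2<n : 2 < n
      2<n = ℕ.≤-trans (s≤s (s≤s (s≤s z≤n))) (ℕ.≤-reflexive len)
      start : place (at (true ∷ true ∷ false ∷ true ∷ pegPairs m)) ≡ OneHole H (vertex 2)
      start = oneHole-place (true ∷ true ∷ false ∷ true ∷ pegPairs m) 2<n refl λ where
        zero                      _ _   → refl
        (suc zero)                _ _   → refl
        (suc (suc zero))          _ 2≢2 → ⊥-elim (2≢2 refl)
        (suc (suc (suc zero)))    _ _   → refl
        (suc (suc (suc (suc i)))) i<n _ →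
          at-pegPairs m (s≤s⁻¹ (s≤s⁻¹ (s≤s⁻¹ (s≤s⁻¹ (subst (4 + i <_) (sym len) i<n)))))
      reach : Reach H (OneHole H (vertex 2)) (place (at (false ∷ swept (suc m))))
      reach = subst (λ c → Reach H c (place (at (false ∷ swept (suc m))))) start
        (reach-window [] (true ∷ pegPairs m) rightward 2<n (sweep (false ∷ []) (suc m) len))

    independenceNumber : IndependenceNumber H ⌈ n /2⌉
    independenceNumber =
      ( place (at (alternating n))
      , place-independent (alternating-onParity n)
      , trans (∣place∣ (alternating n) (length-alternating n)) (pegs-alternating n))
      , independent-≤

data EvenOrOdd : ℕ → Set where
  even : ∀ m → EvenOrOdd (m + m)
  odd  : ∀ m → EvenOrOdd (suc (m + m))

evenOrOdd : ∀ n → EvenOrOdd n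
evenOrOdd zero = even 0
evenOrOdd (suc n) with evenOrOdd n
... | even m = odd m
... | odd m  = subst EvenOrOdd (cong suc (ℕ.+-suc m m)) (even (suc m))

lemma3p5 : ∀ (n : ℕ) (H : Graph n) → 4 ≤ n → Connected H → Bipartite H →
    HamiltonianPath H →
    FoolsAtLeast H (⌈ n /2⌉ ∸ 1) × IndependenceNumber H ⌈ n /2⌉
-- Connectivity is implied by the Hamiltonian path.
lemma3p5 n H _ _ (col , proper) (p , p-injective , p-path) with evenOrOdd n
... | odd m = subst (FoolsAtLeast H) (ℕ.n≡⌊n+n/2⌋ m)
                (fools-odd col proper m (cong suc (length-pegPairs m)))
            , independenceNumber col proper
  where open AlongPath H p-injective p-path
lemma3p5 _ H () _ _ _ | even zero
lemma3p5 _ H (s≤s (s≤s ())) _ _ _ | even (suc zero)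
lemma3p5 _ H _ _ (col , proper) (p , p-injective , p-path) | even (suc (suc m)) =
  subst (FoolsAtLeast H) (cong (_∸ 1) (ℕ.n≡⌈n+n/2⌉ (suc (suc m))))
    (fools-even col proper m (length-pegPairs (suc (suc m))))
  , independenceNumber col proper
  where open AlongPath H p-injective p-path
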